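{- Let $v>1$ be an admissible integer with $v\equiv1$ or $9\pmod{12}$. Then no Steiner triple system of order $v$ has a Veblen point.
   Context: A Steiner triple system (STS) of order $v$ is a set of $v$ points with a family of 3-subsets (triples) such that every 2-subset lies in exactly one triple; an integer is admissible if it is congruent to $1$ or $3$ modulo $6$. A point $x$ is a Veblen point if whenever $\{x,a,b\},\{x,c,d\},\{y,a,c\}$ are triples, also $\{y,b,d\}$ is a triple. -}

module Defs where

open import Level using (0ℓ)
open import Data.Nat using (ℕ; _%_; _>_)
open import Data.Fin using (Fin)
open import Data.Fin.Subset using (Subset; _∈_; _∪_; ⁅_⁆; ∣_∣)
open import Data.Product using (Σ; _×_; _,_; ∃)
open import Data.Sum using (_⊎_)
open import Relation.Binary.PropositionalEquality using (_≡_)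
open import Relation.Nullary using (¬_)

Admissible : ℕ → Set
Admissible v = (v % 6 ≡ 1) ⊎ (v % 6 ≡ 3)

⟪_,_,_⟫ : ∀ {v} → Fin v → Fin v → Fin v → Subset v
⟪ x , y , z ⟫ = ⁅ x ⁆ ∪ (⁅ y ⁆ ∪ ⁅ z ⁆)

record STS (v : ℕ) : Set₁ where
  field
    Block      : Subset v → Set
    block-size : ∀ B → Block B → ∣ B ∣ ≡ 3
    pair-cover : ∀ (x y : Fin v) → ¬ (x ≡ y) →
                 Σ (Subset v) λ B → Block B × x ∈ B × y ∈ B
    pair-unique : ∀ (x y : Fin v) → ¬ (x ≡ y) → ∀ B B′ →
                  Block B → x ∈ B → y ∈ B →
                  Block B′ → x ∈ B′ → y ∈ B′ → B ≡ B′

open STS public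

IsVeblenPoint : ∀ {v} → STS v → Fin v → Set
IsVeblenPoint {v} S x =
  ∀ (y a b c d : Fin v) →
    Block S ⟪ x , a , b ⟫ → Block S ⟪ x , c , d ⟫ → Block S ⟪ y , a , c ⟫ →
    Block S ⟪ y , b , d ⟫

{-# OPTIONS --safe #-}
-- Write a · b for the third point of the block through a ≢ b, and a · a = a: this is a
-- commutative idempotent quasigroup with a · (a · b) ≡ b.  If x is a Veblen point and y ≢ x,
-- the Veblen condition makes the involutions b ↦ x · b and b ↦ y · b commute on
-- the v − 3 points off the line {x, y, x · y}.  Neither they nor their product has a fixed
-- point there, so the Klein four-group they generate acts freely and 4 divides v − 3.  Hence
-- v ≡ 3 (mod 4), whereas v ≡ 1 or 9 (mod 12) forces v ≡ 1 (mod 4).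
module Submission where

open import Defs
open import Data.Nat using (ℕ; suc; _+_; _*_; _∸_; _%_; _≤_; _>_; NonZero; s≤s)
open import Data.Nat.Properties
  using (module ≤-Reasoning; ≤-reflexive; ≤-trans; n≤1+n; +-suc; <-irrefl; ≤⇒≯; m+[n∸m]≡n)
open import Data.Nat.DivMod using ([m+kn]%n≡m%n; m∣n⇒o%n%m≡o%m)
open import Data.Nat.Divisibility using (_∣_; divides; _∣0; ∣-refl; ∣m∣n⇒∣m+n)
open import Data.Vec using ([]; _∷_; here; there)
open import Data.Fin using (Fin; zero; suc; _≟_; punchIn)
open import Data.Fin.Properties using (punchInᵢ≢i)
open import Data.Fin.Subset
open import Data.Fin.Subset.Properties
open import Data.Fin.Subset.Induction using (Acc; acc; ⊂-wellFounded)
open import Data.Product using (Σ; ∃; _×_; _,_; proj₁; proj₂)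
open import Data.Sum using (_⊎_; inj₁; inj₂; [_,_]′)
open import Function using (_∘_; case_of_)
open import Relation.Binary.PropositionalEquality
open import Relation.Nullary using (¬_; Dec; yes; no; contradiction)

private variable
  n : ℕ

r≤m∧d∣m∸r⇒m%d≡r%d : ∀ {d m r} .{{_ : NonZero d}} → r ≤ m → d ∣ m ∸ r → m % d ≡ r % d
r≤m∧d∣m∸r⇒m%d≡r%d {d} {m} {r} r≤m (divides q m∸r≡q*d) = begin
  m % d                ≡⟨ cong (_% d) (sym (m+[n∸m]≡n r≤m)) ⟩
  (r + (m ∸ r)) % d    ≡⟨ cong (λ k → (r + k) % d) m∸r≡q*d ⟩
  (r + q * d) % d      ≡⟨ [m+kn]%n≡m%n r q d ⟩
  r % d                ∎
  where open ≡-Reasoning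

-- Finite subsets and triples

x∈p⇒∣⁅x⁆∪p∣≡∣p∣ : ∀ {x : Fin n} {p} → x ∈ p → ∣ ⁅ x ⁆ ∪ p ∣ ≡ ∣ p ∣
x∈p⇒∣⁅x⁆∪p∣≡∣p∣ {p = _ ∷ p} here = cong suc (cong ∣_∣ (∪-identityˡ p))
x∈p⇒∣⁅x⁆∪p∣≡∣p∣ {p = inside ∷ p} (there x∈p) = cong suc (x∈p⇒∣⁅x⁆∪p∣≡∣p∣ x∈p)
x∈p⇒∣⁅x⁆∪p∣≡∣p∣ {p = outside ∷ p} (there x∈p) = x∈p⇒∣⁅x⁆∪p∣≡∣p∣ x∈p

x∉p⇒∣⁅x⁆∪p∣≡1+∣p∣ : ∀ {x : Fin n} {p} → x ∉ p → ∣ ⁅ x ⁆ ∪ p ∣ ≡ suc ∣ p ∣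
x∉p⇒∣⁅x⁆∪p∣≡1+∣p∣ {x = zero} {outside ∷ p} x∉p = cong suc (cong ∣_∣ (∪-identityˡ p))
x∉p⇒∣⁅x⁆∪p∣≡1+∣p∣ {x = zero} {inside ∷ p} x∉p = contradiction here x∉p
x∉p⇒∣⁅x⁆∪p∣≡1+∣p∣ {x = suc x} {outside ∷ p} x∉p = x∉p⇒∣⁅x⁆∪p∣≡1+∣p∣ (x∉p ∘ there)
x∉p⇒∣⁅x⁆∪p∣≡1+∣p∣ {x = suc x} {inside ∷ p} x∉p = cong suc (x∉p⇒∣⁅x⁆∪p∣≡1+∣p∣ (x∉p ∘ there))

∣⁅x⁆∪p∣≤1+∣p∣ : ∀ (x : Fin n) p → ∣ ⁅ x ⁆ ∪ p ∣ ≤ suc ∣ p ∣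
∣⁅x⁆∪p∣≤1+∣p∣ x p with x ∈? p
... | yes x∈p = ≤-trans (≤-reflexive (x∈p⇒∣⁅x⁆∪p∣≡∣p∣ x∈p)) (n≤1+n _)
... | no x∉p = ≤-reflexive (x∉p⇒∣⁅x⁆∪p∣≡1+∣p∣ x∉p)

x∈p─q⇒x∉q : ∀ {x : Fin n} {p q} → x ∈ p ─ q → x ∉ q
x∈p─q⇒x∉q {p = inside ∷ p} {outside ∷ q} here ()
x∈p─q⇒x∉q {p = _ ∷ p} {_ ∷ q} (there x∈p─q) (there x∈q) = x∈p─q⇒x∉q x∈p─q x∈q

q⊆p⇒∣p∣≡∣p─q∣+∣q∣ : ∀ {p q : Subset n} → q ⊆ p → ∣ p ∣ ≡ ∣ p ─ q ∣ + ∣ q ∣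
q⊆p⇒∣p∣≡∣p─q∣+∣q∣ {p = []} {[]} _ = refl
q⊆p⇒∣p∣≡∣p─q∣+∣q∣ {p = inside ∷ p} {inside ∷ q} q⊆p =
  trans (cong suc (q⊆p⇒∣p∣≡∣p─q∣+∣q∣ (drop-∷-⊆ q⊆p))) (sym (+-suc _ _))
q⊆p⇒∣p∣≡∣p─q∣+∣q∣ {p = inside ∷ p} {outside ∷ q} q⊆p = cong suc (q⊆p⇒∣p∣≡∣p─q∣+∣q∣ (drop-∷-⊆ q⊆p))
q⊆p⇒∣p∣≡∣p─q∣+∣q∣ {p = outside ∷ p} {outside ∷ q} q⊆p = q⊆p⇒∣p∣≡∣p─q∣+∣q∣ (drop-∷-⊆ q⊆p)
q⊆p⇒∣p∣≡∣p─q∣+∣q∣ {p = outside ∷ p} {inside ∷ q} q⊆p = contradiction (q⊆p here) λ ()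

p⊆q∧∣q∣≤∣p∣⇒p≡q : ∀ {p q : Subset n} → p ⊆ q → ∣ q ∣ ≤ ∣ p ∣ → p ≡ q
p⊆q∧∣q∣≤∣p∣⇒p≡q {p = p} p⊆q ∣q∣≤∣p∣ = ⊆-antisym p⊆q q⊆p
  where
  q⊆p : _ ⊆ p
  q⊆p {x} x∈q with x ∈? p
  ... | yes x∈p = x∈p
  ... | no x∉p = contradiction (p⊂q⇒∣p∣<∣q∣ (p⊆q , x , x∈q , x∉p)) (≤⇒≯ ∣q∣≤∣p∣)

module _ {a b c : Fin n} where

  ∈⟪⟫⁻ : ∀ {w} → w ∈ ⟪ a , b , c ⟫ → w ≡ a ⊎ w ≡ b ⊎ w ≡ c
  ∈⟪⟫⁻ w∈ with x∈p∪q⁻ ⁅ a ⁆ _ w∈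
  ... | inj₁ w∈a = inj₁ (x∈⁅y⁆⇒x≡y a w∈a)
  ... | inj₂ w∈bc with x∈p∪q⁻ ⁅ b ⁆ ⁅ c ⁆ w∈bc
  ...   | inj₁ w∈b = inj₂ (inj₁ (x∈⁅y⁆⇒x≡y b w∈b))
  ...   | inj₂ w∈c = inj₂ (inj₂ (x∈⁅y⁆⇒x≡y c w∈c))

  a∈⟪a,b,c⟫ : a ∈ ⟪ a , b , c ⟫
  a∈⟪a,b,c⟫ = x∈p∪q⁺ (inj₁ (x∈⁅x⁆ a))

  b∈⟪a,b,c⟫ : b ∈ ⟪ a , b , c ⟫
  b∈⟪a,b,c⟫ = x∈p∪q⁺ (inj₂ (x∈p∪q⁺ (inj₁ (x∈⁅x⁆ b))))

  c∈⟪a,b,c⟫ : c ∈ ⟪ a , b , c ⟫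
  c∈⟪a,b,c⟫ = x∈p∪q⁺ (inj₂ (x∈p∪q⁺ (inj₂ (x∈⁅x⁆ c))))

  ∉⟪⟫⁺ : ∀ {w} → w ≢ a → w ≢ b → w ≢ c → w ∉ ⟪ a , b , c ⟫
  ∉⟪⟫⁺ w≢a w≢b w≢c w∈ = [ w≢a , [ w≢b , w≢c ]′ ]′ (∈⟪⟫⁻ w∈)

  ∉⟪⟫⁻ : ∀ {w} → w ∉ ⟪ a , b , c ⟫ → w ≢ a × w ≢ b × w ≢ c
  ∉⟪⟫⁻ w∉ = (λ { refl → w∉ a∈⟪a,b,c⟫ }) , (λ { refl → w∉ b∈⟪a,b,c⟫ }) , (λ { refl → w∉ c∈⟪a,b,c⟫ })

  ⟪⟫-swap₁₂ : ⟪ a , b , c ⟫ ≡ ⟪ b , a , c ⟫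
  ⟪⟫-swap₁₂ = trans (sym (∪-assoc ⁅ a ⁆ ⁅ b ⁆ ⁅ c ⁆))
             (trans (cong (_∪ ⁅ c ⁆) (∪-comm ⁅ a ⁆ ⁅ b ⁆)) (∪-assoc ⁅ b ⁆ ⁅ a ⁆ ⁅ c ⁆))

  ⟪⟫-swap₂₃ : ⟪ a , b , c ⟫ ≡ ⟪ a , c , b ⟫
  ⟪⟫-swap₂₃ = cong (⁅ a ⁆ ∪_) (∪-comm ⁅ b ⁆ ⁅ c ⁆)

  ∣⟪⟫∣≡3 : a ≢ b → a ≢ c → b ≢ c → ∣ ⟪ a , b , c ⟫ ∣ ≡ 3
  ∣⟪⟫∣≡3 a≢b a≢c b≢c = begin
    ∣ ⁅ a ⁆ ∪ (⁅ b ⁆ ∪ ⁅ c ⁆) ∣  ≡⟨ x∉p⇒∣⁅x⁆∪p∣≡1+∣p∣ a∉⁅b⁆∪⁅c⁆ ⟩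
    suc ∣ ⁅ b ⁆ ∪ ⁅ c ⁆ ∣        ≡⟨ cong suc (x∉p⇒∣⁅x⁆∪p∣≡1+∣p∣ (x≢y⇒x∉⁅y⁆ b≢c)) ⟩
    suc (suc ∣ ⁅ c ⁆ ∣)          ≡⟨ cong (2 +_) (∣⁅x⁆∣≡1 c) ⟩
    3                            ∎
    where
    open ≡-Reasoning
    a∉⁅b⁆∪⁅c⁆ : a ∉ ⁅ b ⁆ ∪ ⁅ c ⁆
    a∉⁅b⁆∪⁅c⁆ a∈ = [ x≢y⇒x∉⁅y⁆ a≢b , x≢y⇒x∉⁅y⁆ a≢c ]′ (x∈p∪q⁻ ⁅ b ⁆ ⁅ c ⁆ a∈)

  ∣⟪⟫∣≡3⇒distinct : ∣ ⟪ a , b , c ⟫ ∣ ≡ 3 → a ≢ b × a ≢ c × b ≢ c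
  ∣⟪⟫∣≡3⇒distinct ∣abc∣≡3 =
      (λ { refl → 3≰∣abc∣ (∣⟪⟫∣≤2 (inj₁ (x∈p∪q⁺ (inj₁ (x∈⁅x⁆ a))))) })
    , (λ { refl → 3≰∣abc∣ (∣⟪⟫∣≤2 (inj₁ (x∈p∪q⁺ (inj₂ (x∈⁅x⁆ a))))) })
    , (λ { refl → 3≰∣abc∣ (∣⟪⟫∣≤2 (inj₂ (x∈⁅x⁆ b))) })
    where
    3≰∣abc∣ : ¬ ∣ ⟪ a , b , c ⟫ ∣ ≤ 2
    3≰∣abc∣ h = <-irrefl refl (subst (_≤ 2) ∣abc∣≡3 h)
    open ≤-Reasoning
    ∣⟪⟫∣≤2 : a ∈ ⁅ b ⁆ ∪ ⁅ c ⁆ ⊎ b ∈ ⁅ c ⁆ → ∣ ⟪ a , b , c ⟫ ∣ ≤ 2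
    ∣⟪⟫∣≤2 (inj₁ a∈) = begin
      ∣ ⁅ a ⁆ ∪ (⁅ b ⁆ ∪ ⁅ c ⁆) ∣  ≡⟨ x∈p⇒∣⁅x⁆∪p∣≡∣p∣ a∈ ⟩
      ∣ ⁅ b ⁆ ∪ ⁅ c ⁆ ∣            ≤⟨ ∣⁅x⁆∪p∣≤1+∣p∣ b ⁅ c ⁆ ⟩
      suc ∣ ⁅ c ⁆ ∣                ≡⟨ cong suc (∣⁅x⁆∣≡1 c) ⟩
      2                            ∎
    ∣⟪⟫∣≤2 (inj₂ b∈) = begin
      ∣ ⁅ a ⁆ ∪ (⁅ b ⁆ ∪ ⁅ c ⁆) ∣  ≤⟨ ∣⁅x⁆∪p∣≤1+∣p∣ a _ ⟩
      suc ∣ ⁅ b ⁆ ∪ ⁅ c ⁆ ∣        ≡⟨ cong suc (x∈p⇒∣⁅x⁆∪p∣≡∣p∣ b∈) ⟩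
      suc ∣ ⁅ c ⁆ ∣                ≡⟨ cong suc (∣⁅x⁆∣≡1 c) ⟩
      2                            ∎

∣B∣≡3⇒B≡⟪p,q,t⟫ : ∀ {B : Subset n} {p q} → ∣ B ∣ ≡ 3 → p ∈ B → q ∈ B → p ≢ q →
                  ∃ λ t → B ≡ ⟪ p , q , t ⟫
∣B∣≡3⇒B≡⟪p,q,t⟫ {n} {B} {p} {q} ∣B∣≡3 p∈B q∈B p≢q = third (nonempty? (B ─ pq))
  where
  pq : Subset n
  pq = ⁅ p ⁆ ∪ ⁅ q ⁆

  pq⊆B : pq ⊆ B
  pq⊆B w∈ with x∈p∪q⁻ ⁅ p ⁆ ⁅ q ⁆ w∈
  ... | inj₁ w∈⁅p⁆ rewrite x∈⁅y⁆⇒x≡y p w∈⁅p⁆ = p∈B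
  ... | inj₂ w∈⁅q⁆ rewrite x∈⁅y⁆⇒x≡y q w∈⁅q⁆ = q∈B

  ∣pq∣≡2 : ∣ pq ∣ ≡ 2
  ∣pq∣≡2 = trans (x∉p⇒∣⁅x⁆∪p∣≡1+∣p∣ (x≢y⇒x∉⁅y⁆ p≢q)) (cong suc (∣⁅x⁆∣≡1 q))

  third : Dec (Nonempty (B ─ pq)) → ∃ λ t → B ≡ ⟪ p , q , t ⟫
  third (no B─pq-empty) = contradiction (trans (sym ∣B∣≡3) ∣B∣≡2) λ ()
    where
    open ≡-Reasoning
    ∣B∣≡2 : ∣ B ∣ ≡ 2
    ∣B∣≡2 = begin
      ∣ B ∣                ≡⟨ q⊆p⇒∣p∣≡∣p─q∣+∣q∣ pq⊆B ⟩
      ∣ B ─ pq ∣ + ∣ pq ∣  ≡⟨ cong (λ r → ∣ r ∣ + ∣ pq ∣) (Empty-unique B─pq-empty) ⟩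
      ∣ ⊥ {n} ∣ + ∣ pq ∣   ≡⟨ cong₂ _+_ (∣⊥∣≡0 n) ∣pq∣≡2 ⟩
      2                    ∎
  third (yes (t , t∈B─pq)) =
    t , sym (p⊆q∧∣q∣≤∣p∣⇒p≡q pqt⊆B (≤-reflexive (trans ∣B∣≡3 (sym ∣pqt∣≡3))))
    where
    t∉pq : t ∉ pq
    t∉pq = x∈p─q⇒x∉q t∈B─pq
    pqt⊆B : ⟪ p , q , t ⟫ ⊆ B
    pqt⊆B w∈ with ∈⟪⟫⁻ w∈
    ... | inj₁ refl = p∈B
    ... | inj₂ (inj₁ refl) = q∈B
    ... | inj₂ (inj₂ refl) = p─q⊆p B pq t∈B─pq
    ∣pqt∣≡3 : ∣ ⟪ p , q , t ⟫ ∣ ≡ 3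
    ∣pqt∣≡3 = ∣⟪⟫∣≡3 p≢q (λ { refl → t∉pq (x∈p∪q⁺ (inj₁ (x∈⁅x⁆ p))) })
                        (λ { refl → t∉pq (x∈p∪q⁺ (inj₂ (x∈⁅x⁆ q))) })

-- Free actions of the Klein four-group

Closed : (Fin n → Fin n) → Subset n → Set
Closed h p = ∀ {b} → b ∈ p → h b ∈ p

─-closed : ∀ {h : Fin n → Fin n} {p o} → Closed h p → (∀ {b} → b ∈ p → h (h b) ≡ b) →
           Closed h o → Closed h (p ─ o)
─-closed {p = p} {o} p-closed h-involutive o-closed {b} b∈p─o =
  x∈p∧x∉q⇒x∈p─q (p-closed b∈p) λ hb∈o →
    x∈p─q⇒x∉q b∈p─o (subst (_∈ o) (h-involutive b∈p) (o-closed hb∈o))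
  where
  b∈p : b ∈ p
  b∈p = p─q⊆p p o b∈p─o

record IsFreeKleinFourAction (f g : Fin n → Fin n) (p : Subset n) : Set where
  field
    f-closed     : Closed f p
    g-closed     : Closed g p
    f-involutive : ∀ {b} → b ∈ p → f (f b) ≡ b
    g-involutive : ∀ {b} → b ∈ p → g (g b) ≡ b
    f∘g≡g∘f      : ∀ {b} → b ∈ p → f (g b) ≡ g (f b)
    f-free       : ∀ {b} → b ∈ p → f b ≢ b
    g-free       : ∀ {b} → b ∈ p → g b ≢ b
    f∘g-free     : ∀ {b} → b ∈ p → f (g b) ≢ b

module _ {f g : Fin n → Fin n} {p : Subset n} (action : IsFreeKleinFourAction f g p) where
  open IsFreeKleinFourAction action

  private
    orbit : Fin n → Subset n
    orbit a = ⁅ a ⁆ ∪ ⟪ f a , g a , f (g a) ⟫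

    module _ {a : Fin n} where
      a∈orbit : a ∈ orbit a
      a∈orbit = x∈p∪q⁺ (inj₁ (x∈⁅x⁆ a))

      fa∈orbit : f a ∈ orbit a
      fa∈orbit = x∈p∪q⁺ (inj₂ a∈⟪a,b,c⟫)

      ga∈orbit : g a ∈ orbit a
      ga∈orbit = x∈p∪q⁺ (inj₂ b∈⟪a,b,c⟫)

      fga∈orbit : f (g a) ∈ orbit a
      fga∈orbit = x∈p∪q⁺ (inj₂ c∈⟪a,b,c⟫)

      ∈orbit-elim : ∀ {ℓ} (P : Fin n → Set ℓ) → P a → P (f a) → P (g a) → P (f (g a)) →
                    ∀ {b} → b ∈ orbit a → P b
      ∈orbit-elim P Pa Pfa Pga Pfga b∈ with x∈p∪q⁻ ⁅ a ⁆ _ b∈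
      ... | inj₁ b∈⁅a⁆ rewrite x∈⁅y⁆⇒x≡y a b∈⁅a⁆ = Pa
      ... | inj₂ b∈fga with ∈⟪⟫⁻ b∈fga
      ...   | inj₁ refl = Pfa
      ...   | inj₂ (inj₁ refl) = Pga
      ...   | inj₂ (inj₂ refl) = Pfga

    orbit⊆ : ∀ {a q} → a ∈ q → Closed f q → Closed g q → orbit a ⊆ q
    orbit⊆ {q = q} a∈q f-closed-q g-closed-q =
      ∈orbit-elim (_∈ q) a∈q (f-closed-q a∈q) (g-closed-q a∈q) (f-closed-q (g-closed-q a∈q))

    orbit-f-closed : ∀ {a} → a ∈ p → Closed f (orbit a)
    orbit-f-closed {a} a∈p = ∈orbit-elim (λ b → f b ∈ orbit a)
      fa∈orbit
      (subst (_∈ orbit a) (sym (f-involutive a∈p)) a∈orbit)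
      fga∈orbit
      (subst (_∈ orbit a) (sym (f-involutive (g-closed a∈p))) ga∈orbit)

    orbit-g-closed : ∀ {a} → a ∈ p → Closed g (orbit a)
    orbit-g-closed {a} a∈p = ∈orbit-elim (λ b → g b ∈ orbit a)
      ga∈orbit
      (subst (_∈ orbit a) (f∘g≡g∘f a∈p) fga∈orbit)
      (subst (_∈ orbit a) (sym (g-involutive a∈p)) a∈orbit)
      (subst (_∈ orbit a) fa≡gfga fa∈orbit)
      where
      fa≡gfga : f a ≡ g (f (g a))
      fa≡gfga = sym (trans (cong g (f∘g≡g∘f a∈p)) (g-involutive (f-closed a∈p)))

    ∣orbit∣≡4 : ∀ {a} → a ∈ p → ∣ orbit a ∣ ≡ 4
    ∣orbit∣≡4 {a} a∈p = trans (x∉p⇒∣⁅x⁆∪p∣≡1+∣p∣ a∉fga) (cong suc (∣⟪⟫∣≡3 fa≢ga fa≢fga ga≢fga))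
      where
      ga∈p : g a ∈ p
      ga∈p = g-closed a∈p
      f-injective : ∀ {b c} → b ∈ p → c ∈ p → f b ≡ f c → b ≡ c
      f-injective b∈p c∈p fb≡fc =
        trans (sym (f-involutive b∈p)) (trans (cong f fb≡fc) (f-involutive c∈p))
      a∉fga : a ∉ ⟪ f a , g a , f (g a) ⟫
      a∉fga a∈ with ∈⟪⟫⁻ a∈
      ... | inj₁ a≡fa = f-free a∈p (sym a≡fa)
      ... | inj₂ (inj₁ a≡ga) = g-free a∈p (sym a≡ga)
      ... | inj₂ (inj₂ a≡fga) = f∘g-free a∈p (sym a≡fga)
      fa≢ga : f a ≢ g a
      fa≢ga fa≡ga = f∘g-free a∈p (trans (cong f (sym fa≡ga)) (f-involutive a∈p))
      fa≢fga : f a ≢ f (g a)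
      fa≢fga fa≡fga = g-free a∈p (sym (f-injective a∈p ga∈p fa≡fga))
      ga≢fga : g a ≢ f (g a)
      ga≢fga ga≡fga = f-free ga∈p (sym ga≡fga)

    4∣∣q∣ : ∀ {q} → Acc _⊂_ q → q ⊆ p → Closed f q → Closed g q → 4 ∣ ∣ q ∣
    4∣∣q∣ {q} (acc rec) q⊆p f-closed-q g-closed-q with nonempty? q
    ... | no q-empty = subst (4 ∣_) (sym (trans (cong ∣_∣ (Empty-unique q-empty)) (∣⊥∣≡0 n))) (4 ∣0)
    ... | yes (a , a∈q) = subst (4 ∣_) (sym ∣q∣≡∣q─o∣+4) (∣m∣n⇒∣m+n 4∣∣q─o∣ ∣-refl)
      where
      a∈p : a ∈ p
      a∈p = q⊆p a∈q
      o : Subset n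
      o = orbit a
      o⊆q : o ⊆ q
      o⊆q = orbit⊆ a∈q f-closed-q g-closed-q
      ∣q∣≡∣q─o∣+4 : ∣ q ∣ ≡ ∣ q ─ o ∣ + 4
      ∣q∣≡∣q─o∣+4 = trans (q⊆p⇒∣p∣≡∣p─q∣+∣q∣ o⊆q) (cong (∣ q ─ o ∣ +_) (∣orbit∣≡4 a∈p))
      4∣∣q─o∣ : 4 ∣ ∣ q ─ o ∣
      4∣∣q─o∣ = 4∣∣q∣ (rec (p∩q≢∅⇒p─q⊂p q o (a , x∈p∩q⁺ (a∈q , a∈orbit))))
        (λ b∈ → q⊆p (p─q⊆p q o b∈))
        (─-closed f-closed-q (λ b∈q → f-involutive (q⊆p b∈q)) (orbit-f-closed a∈p))
        (─-closed g-closed-q (λ b∈q → g-involutive (q⊆p b∈q)) (orbit-g-closed a∈p))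

  4∣∣p∣ : 4 ∣ ∣ p ∣
  4∣∣p∣ = 4∣∣q∣ (⊂-wellFounded p) ⊆-refl f-closed g-closed

-- Steiner quasigroups and Veblen points

module SteinerQuasigroup {v} (S : STS v) where

  block-distinct : ∀ {a b c} → Block S ⟪ a , b , c ⟫ → a ≢ b × a ≢ c × b ≢ c
  block-distinct abc = ∣⟪⟫∣≡3⇒distinct (block-size S _ abc)

  private
    third-point : ∀ {a b} → a ≢ b → ∃ λ c → Block S ⟪ a , b , c ⟫
    third-point {a} {b} a≢b with pair-cover S a b a≢b
    ... | B , B-block , a∈B , b∈B with ∣B∣≡3⇒B≡⟪p,q,t⟫ (block-size S B B-block) a∈B b∈B a≢b
    ...   | c , refl = c , B-block

  infixl 7 _·_
  _·_ : Fin v → Fin v → Fin v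
  a · b with a ≟ b
  ... | yes _ = a
  ... | no a≢b = proj₁ (third-point a≢b)

  ·-idem : ∀ a → a · a ≡ a
  ·-idem a with a ≟ a
  ... | yes _ = refl
  ... | no a≢a = contradiction refl a≢a

  ·-block : ∀ {a b} → a ≢ b → Block S ⟪ a , b , a · b ⟫
  ·-block {a} {b} a≢b with a ≟ b
  ... | yes a≡b = contradiction a≡b a≢b
  ... | no a≢b = proj₂ (third-point a≢b)

  block⇒· : ∀ {a b c} → Block S ⟪ a , b , c ⟫ → a · b ≡ c
  block⇒· {a} {b} {c} abc with block-distinct abc
  ... | a≢b , a≢c , b≢c with ∈⟪⟫⁻ c∈⟪a,b,a·b⟫
    where
    c∈⟪a,b,a·b⟫ : c ∈ ⟪ a , b , a · b ⟫
    c∈⟪a,b,a·b⟫ = subst (c ∈_) (pair-unique S a b a≢b _ _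
      abc a∈⟪a,b,c⟫ b∈⟪a,b,c⟫ (·-block a≢b) a∈⟪a,b,c⟫ b∈⟪a,b,c⟫) c∈⟪a,b,c⟫
  ...   | inj₁ c≡a = contradiction (sym c≡a) a≢c
  ...   | inj₂ (inj₁ c≡b) = contradiction (sym c≡b) b≢c
  ...   | inj₂ (inj₂ c≡a·b) = sym c≡a·b

  ·-comm : ∀ a b → a · b ≡ b · a
  ·-comm a b = case a ≟ b of λ where
    (yes refl) → refl
    (no a≢b)   → sym (block⇒· (subst (Block S) ⟪⟫-swap₁₂ (·-block a≢b)))

  ·-inverse : ∀ a b → a · (a · b) ≡ b
  ·-inverse a b = case a ≟ b of λ where
    (yes refl) → trans (cong (a ·_) (·-idem a)) (·-idem a)
    (no a≢b)   → block⇒· (subst (Block S) ⟪⟫-swap₂₃ (·-block a≢b))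

  line : Fin v → Fin v → Subset v
  line a b = ⟪ a , b , a · b ⟫

module SteinerQuasigroupProperties {A : Set} (_·_ : A → A → A)
  (·-idem : ∀ a → a · a ≡ a) (·-comm : ∀ a b → a · b ≡ b · a)
  (·-inverse : ∀ a b → a · (a · b) ≡ b) where

  a·b≡c⇒b≡a·c : ∀ a {b c} → a · b ≡ c → b ≡ a · c
  a·b≡c⇒b≡a·c a {b} ab≡c = trans (sym (·-inverse a b)) (cong (a ·_) ab≡c)

  ·-cancelˡ : ∀ a {b c} → a · b ≡ a · c → b ≡ c
  ·-cancelˡ a {b} {c} ab≡ac = trans (a·b≡c⇒b≡a·c a ab≡ac) (·-inverse a c)

  ·-cancelʳ : ∀ {a b} c → a · c ≡ b · c → a ≡ b
  ·-cancelʳ {a} {b} c ac≡bc = ·-cancelˡ c (trans (·-comm c a) (trans ac≡bc (·-comm b c)))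

  a·b≡a⇒b≡a : ∀ {a b} → a · b ≡ a → b ≡ a
  a·b≡a⇒b≡a {a} ab≡a = ·-cancelˡ a (trans ab≡a (sym (·-idem a)))

  a·b≡b⇒a≡b : ∀ {a b} → a · b ≡ b → a ≡ b
  a·b≡b⇒a≡b {a} {b} ab≡b = ·-cancelʳ b (trans ab≡b (sym (·-idem b)))

module _ {v} (S : STS v) {x : Fin v} (veblen : IsVeblenPoint S x) where
  open SteinerQuasigroup S
  open SteinerQuasigroupProperties _·_ ·-idem ·-comm ·-inverse

  veblen-commute : ∀ {y b} → b ≢ x → b ≢ y → y · b ≢ x → y · (x · b) ≡ x · (y · b)
  veblen-commute {y} {b} b≢x b≢y y·b≢x = block⇒· (veblen y b (x · b) (y · b) (x · (y · b))
    (·-block (b≢x ∘ sym)) (·-block (y·b≢x ∘ sym)) (·-block (b≢y ∘ sym)))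

  module _ {y : Fin v} (y≢x : y ≢ x) where
    private
      ∈∁line⁺ : ∀ {b} → b ≢ x → b ≢ y → b ≢ x · y → b ∈ ∁ (line x y)
      ∈∁line⁺ b≢x b≢y b≢xy = x∉p⇒x∈∁p (∉⟪⟫⁺ b≢x b≢y b≢xy)

      ∈∁line⁻ : ∀ {b} → b ∈ ∁ (line x y) → b ≢ x × b ≢ y × b ≢ x · y
      ∈∁line⁻ b∈∁line = ∉⟪⟫⁻ (x∈∁p⇒x∉p b∈∁line)

      x·-closed : Closed (x ·_) (∁ (line x y))
      x·-closed b∈∁line with ∈∁line⁻ b∈∁line
      ... | b≢x , b≢y , b≢xy =
        ∈∁line⁺ (b≢x ∘ a·b≡a⇒b≡a) (b≢xy ∘ a·b≡c⇒b≡a·c x) (b≢y ∘ ·-cancelˡ x)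

      y·-closed : Closed (y ·_) (∁ (line x y))
      y·-closed b∈∁line with ∈∁line⁻ b∈∁line
      ... | b≢x , b≢y , b≢xy = ∈∁line⁺
        (λ yb≡x → b≢xy (trans (a·b≡c⇒b≡a·c y yb≡x) (·-comm y x)))
        (b≢y ∘ a·b≡a⇒b≡a)
        (λ yb≡xy → b≢x (·-cancelˡ y (trans yb≡xy (·-comm x y))))

    veblen⇒freeKleinFourAction : IsFreeKleinFourAction (y ·_) (x ·_) (∁ (line x y))
    veblen⇒freeKleinFourAction = record
      { f-closed     = y·-closed
      ; g-closed     = x·-closed
      ; f-involutive = λ {b} _ → ·-inverse y b
      ; g-involutive = λ {b} _ → ·-inverse x b
      ; f∘g≡g∘f      = λ b∈∁line → let b≢x , b≢y , _ = ∈∁line⁻ b∈∁line in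
                         veblen-commute b≢x b≢y (proj₁ (∈∁line⁻ (y·-closed b∈∁line)))
      ; f-free       = λ b∈∁line → proj₁ (proj₂ (∈∁line⁻ b∈∁line)) ∘ sym ∘ a·b≡b⇒a≡b
      ; g-free       = λ b∈∁line → proj₁ (∈∁line⁻ b∈∁line) ∘ sym ∘ a·b≡b⇒a≡b
      ; f∘g-free     = λ {b} _ yxb≡b → y≢x (sym (·-cancelʳ b (a·b≡c⇒b≡a·c y yxb≡b)))
      }

    veblen⇒v%4≡3 : v % 4 ≡ 3
    veblen⇒v%4≡3 = r≤m∧d∣m∸r⇒m%d≡r%d 3≤v
      (subst (4 ∣_) ∣∁line∣≡v∸3 (4∣∣p∣ veblen⇒freeKleinFourAction))
      where
      ∣line∣≡3 : ∣ line x y ∣ ≡ 3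
      ∣line∣≡3 = block-size S _ (·-block (y≢x ∘ sym))
      3≤v : 3 ≤ v
      3≤v = subst (_≤ v) ∣line∣≡3 (∣p∣≤n (line x y))
      ∣∁line∣≡v∸3 : ∣ ∁ (line x y) ∣ ≡ v ∸ 3
      ∣∁line∣≡v∸3 = trans (∣∁p∣≡n∸∣p∣ (line x y)) (cong (v ∸_) ∣line∣≡3)

∃≢ : ∀ {n} → n > 1 → (x : Fin n) → ∃ λ y → y ≢ x
∃≢ (s≤s (s≤s _)) x = punchIn x zero , punchInᵢ≢i x zero

v%12≡1∨9⇒v%4≡1 : ∀ v → (v % 12 ≡ 1) ⊎ (v % 12 ≡ 9) → v % 4 ≡ 1
v%12≡1∨9⇒v%4≡1 v v%12≡1∨9 = trans (sym (m∣n⇒o%n%m≡o%m 4 12 v (divides 3 refl))) (v%12%4≡1 v%12≡1∨9)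
  where
  v%12%4≡1 : (v % 12 ≡ 1) ⊎ (v % 12 ≡ 9) → v % 12 % 4 ≡ 1
  v%12%4≡1 (inj₁ v%12≡1) = cong (_% 4) v%12≡1
  v%12%4≡1 (inj₂ v%12≡9) = cong (_% 4) v%12≡9

mainTheorem8 : ∀ (v : ℕ) → v > 1 → Admissible v →
    (v % 12 ≡ 1) ⊎ (v % 12 ≡ 9) →
    (S : STS v) → ¬ (Σ (Fin v) λ x → IsVeblenPoint S x)
mainTheorem8 v v>1 _ v%12≡1∨9 S (x , veblen) = contradiction (trans (sym v%4≡1) v%4≡3) λ ()
  where
  v%4≡1 : v % 4 ≡ 1
  v%4≡1 = v%12≡1∨9⇒v%4≡1 v v%12≡1∨9
  v%4≡3 : v % 4 ≡ 3
  v%4≡3 = veblen⇒v%4≡3 S veblen (proj₂ (∃≢ v>1 x))
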